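{- Let $A,O,E$ be non-empty sets each equipped with an equivalence relation, and let $\phi\subseteq A\times O\times E$. Then for all $X\subseteq A$ and $Y\subseteq O$, $\langle\overline{\phi}\rangle_E(\overline{X},\overline{Y})=\langle\overline{\phi}\rangle_E(X,Y)$.
   Context: For an element $x$ of $A$ (resp. $O$, $E$), $[x]$ denotes its equivalence class. For a subset $X$ of one of these sets, $\overline{X}=\{z:[z]\cap X\neq\emptyset\}$. For $\psi\subseteq A\times O\times E$: $\overline{\psi}=\{\langle a,o,e\rangle:([a]\times[o]\times[e])\cap\psi\neq\emptyset\}$ and $\langle\psi\rangle_E(X,Y)=\{e\in E:(X\times Y\times\{e\})\cap\psi\neq\emptyset\}$. -}

module Defs where

open import Level using (Level; _⊔_; suc)
open import Relation.Binary.Bundles using (Setoid)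
open import Data.Product using (Σ; _×_; _,_; ∃)
open import Relation.Unary using (Pred; _⊆_; _∈_)

-- Subsets are predicates on the carrier (level ℓp).
-- [x] = { z ∣ z ≈ x }; closure  X̄ = { z ∣ [z] ∩ X ≠ ∅ } = { z ∣ ∃ w. w ≈ z ∧ w ∈ X }.
module _ {c ℓ : Level} (S : Setoid c ℓ) where
  open Setoid S
  closure : ∀ {ℓp} → Pred Carrier ℓp → Pred Carrier (c ⊔ ℓ ⊔ ℓp)
  closure X z = Σ Carrier λ w → (w ≈ z) × X w

module _ {a ℓa o ℓo e ℓe : Level}
         (A : Setoid a ℓa) (O : Setoid o ℓo) (E : Setoid e ℓe) where
  private
    module A = Setoid A
    module O = Setoid O
    module E = Setoid E

  Ternary : ∀ ℓp → Set (a ⊔ o ⊔ e ⊔ suc ℓp)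
  Ternary ℓp = A.Carrier → O.Carrier → E.Carrier → Set ℓp

  closure₃ : ∀ {ℓp} → Ternary ℓp → Ternary (a ⊔ o ⊔ e ⊔ ℓa ⊔ ℓo ⊔ ℓe ⊔ ℓp)
  closure₃ ψ x y z =
    Σ A.Carrier λ x′ → Σ O.Carrier λ y′ → Σ E.Carrier λ z′ →
      (x′ A.≈ x) × (y′ O.≈ y) × (z′ E.≈ z) × ψ x′ y′ z′

  projE : ∀ {ℓp ℓx ℓy} → Ternary ℓp → Pred A.Carrier ℓx → Pred O.Carrier ℓy
        → Pred E.Carrier (a ⊔ o ⊔ ℓp ⊔ ℓx ⊔ ℓy)
  projE ψ X Y z = Σ A.Carrier λ x → Σ O.Carrier λ y → X x × Y y × ψ x y z

_≐_ : ∀ {c ℓ₁ ℓ₂} {C : Set c} → Pred C ℓ₁ → Pred C ℓ₂ → Set (c ⊔ ℓ₁ ⊔ ℓ₂)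
P ≐ Q = (P ⊆ Q) × (Q ⊆ P)

{-# OPTIONS --safe #-}
module Submission where

open import Defs
open import Level using (Level; _⊔_)
open import Relation.Binary.Bundles using (Setoid)
open import Relation.Unary using (Pred; _⊆_)
open import Data.Product using (_,_)

module _ {c ℓ : Level} (S : Setoid c ℓ) where
  open Setoid S

  ⊆-closure : ∀ {ℓp} {X : Pred Carrier ℓp} → X ⊆ closure S X
  ⊆-closure {x = x} Xx = x , refl , Xx

module _ {a ℓa o ℓo e ℓe : Level}
         (A : Setoid a ℓa) (O : Setoid o ℓo) (E : Setoid e ℓe) where
  private
    module A = Setoid A
    module O = Setoid O

  Respects₁₂ : ∀ {ℓp} → Ternary A O E ℓp → Set (a ⊔ o ⊔ e ⊔ ℓa ⊔ ℓo ⊔ ℓp)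
  Respects₁₂ ψ = ∀ {x x′ y y′ z} → x A.≈ x′ → y O.≈ y′ → ψ x y z → ψ x′ y′ z

  closure₃-respects₁₂ : ∀ {ℓp} (ψ : Ternary A O E ℓp) → Respects₁₂ (closure₃ A O E ψ)
  closure₃-respects₁₂ ψ x≈x′ y≈y′ (u , v , w , u≈x , v≈y , w≈z , ψuvw) =
    u , v , w , A.trans u≈x x≈x′ , O.trans v≈y y≈y′ , w≈z , ψuvw

  module _ {ℓp ℓx ℓy} {ψ : Ternary A O E ℓp}
           {X : Pred A.Carrier ℓx} {Y : Pred O.Carrier ℓy} where

    projE-mono : ∀ {ℓx′ ℓy′} {X′ : Pred A.Carrier ℓx′} {Y′ : Pred O.Carrier ℓy′} →
                 X ⊆ X′ → Y ⊆ Y′ → projE A O E ψ X Y ⊆ projE A O E ψ X′ Y′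
    projE-mono X⊆X′ Y⊆Y′ (x , y , Xx , Yy , ψxyz) = x , y , X⊆X′ Xx , Y⊆Y′ Yy , ψxyz

    projE-closure-⊆ : Respects₁₂ ψ →
                      projE A O E ψ (closure A X) (closure O Y) ⊆ projE A O E ψ X Y
    projE-closure-⊆ resp (_ , _ , (x , x≈ , Xx) , (y , y≈ , Yy) , ψz) =
      x , y , Xx , Yy , resp (A.sym x≈) (O.sym y≈) ψz

    projE-closure : Respects₁₂ ψ →
                    projE A O E ψ (closure A X) (closure O Y) ≐ projE A O E ψ X Y
    projE-closure resp = projE-closure-⊆ resp , projE-mono (⊆-closure A) (⊆-closure O)

mainTheorem9 : ∀ {a ℓa o ℓo e ℓe ℓφ ℓx ℓy : Level}
    (A : Setoid a ℓa) (O : Setoid o ℓo) (E : Setoid e ℓe) →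
    Setoid.Carrier A → Setoid.Carrier O → Setoid.Carrier E →
    (φ : Ternary A O E ℓφ) →
    (X : Pred (Setoid.Carrier A) ℓx) (Y : Pred (Setoid.Carrier O) ℓy) →
    projE A O E (closure₃ A O E φ) (closure A X) (closure O Y)
      ≐ projE A O E (closure₃ A O E φ) X Y
mainTheorem9 A O E _ _ _ φ X Y = projE-closure A O E (closure₃-respects₁₂ A O E φ)
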